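{- Let $F_1$ and $F_2$ be finite subsets of $\mathbb{Z}^2$ such that $F_1$ is uniquely determined by its row and column sums and $|F_1| = |F_2|$. Let $2\alpha = \sum_{j\in\mathbb{Z}} |c_j^{(1)} - c_j^{(2)}| + \sum_{i\in\mathbb{Z}} |r_i^{(1)} - r_i^{(2)}|$ and $p = |F_1 \cap F_2|$. Then \[ |F_1| \le \sum_{i=1}^{\alpha+p} \left\lfloor \frac{\alpha+p}{i} \right\rfloor. \]
   Context: For $i \in \mathbb{Z}$, row $i$ is $\{(x,y)\in\mathbb{Z}^2 : x = i\}$ and for $j\in\mathbb{Z}$, column $j$ is $\{(x,y)\in\mathbb{Z}^2: y=j\}$. For $h\in\{1,2\}$, $r_i^{(h)}$ is the number of points of $F_h$ in row $i$ and $c_j^{(h)}$ the number of points of $F_h$ in column $j$. $F_1$ is uniquely determined by its row and column sums if no finite subset of $\mathbb{Z}^2$ other than $F_1$ has the same row sums and column sums. The total error in the line sums is always even, hence written $2\alpha$ with $\alpha$ a nonnegative integer. -}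

module Defs where

open import Data.Nat using (ℕ; zero; suc; _+_; _/_; ∣_-_∣)
open import Data.Integer using (ℤ) renaming (_≟_ to _≟ℤ_)
open import Data.Product using (_×_; _,_; proj₁; proj₂)
open import Data.Product.Properties using (≡-dec)
open import Data.List using (List; []; _∷_; length; filter; map; deduplicate; _++_)
open import Data.Nat.ListAction using (sum)
open import Data.List.Relation.Unary.Unique.Propositional using (Unique)
open import Data.List.Membership.Propositional using (_∈_)
open import Relation.Binary.PropositionalEquality using (_≡_)
open import Relation.Binary.Definitions using (DecidableEquality)
open import Relation.Nullary using (Dec)
open import Function.Bundles using (_⇔_)

-- Points of ℤ²: (x , y).  Row i = {x = i}, column j = {y = j}.
Point : Set
Point = ℤ × ℤ

_≟P_ : DecidableEquality Point
_≟P_ = ≡-dec _≟ℤ_ _≟ℤ_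

open import Data.List.Membership.DecPropositional _≟P_ using (_∈?_)

record FinSet : Set where
  constructor finSet
  field
    elems  : List Point
    unique : Unique elems
open FinSet public

∣_∣ : FinSet → ℕ
∣ F ∣ = length (elems F)

rowSum : FinSet → ℤ → ℕ
rowSum F i = length (filter (λ q → proj₁ q ≟ℤ i) (elems F))

colSum : FinSet → ℤ → ℕ
colSum F j = length (filter (λ q → proj₂ q ≟ℤ j) (elems F))

UniquelyDetermined : FinSet → Set
UniquelyDetermined F =
  (G : FinSet) →
  (∀ i → rowSum G i ≡ rowSum F i) →
  (∀ j → colSum G j ≡ colSum F j) →
  ∀ x → (x ∈ elems G) ⇔ (x ∈ elems F)

sumOverDistinct : List ℤ → (ℤ → ℕ) → ℕ
sumOverDistinct is f = sum (map f (deduplicate _≟ℤ_ is))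

-- Only rows/columns meeting F₁ ∪ F₂ have nonzero terms, so the sums over ℤ
-- reduce to sums over the distinct indices occurring in F₁ ∪ F₂.
lineSumError : FinSet → FinSet → ℕ
lineSumError F₁ F₂ =
  sumOverDistinct (map proj₂ (elems F₁ ++ elems F₂))
                  (λ j → ∣ colSum F₁ j - colSum F₂ j ∣)
  + sumOverDistinct (map proj₁ (elems F₁ ++ elems F₂))
                  (λ i → ∣ rowSum F₁ i - rowSum F₂ i ∣)

interCard : FinSet → FinSet → ℕ
interCard F₁ F₂ = length (filter (λ q → q ∈? elems F₂) (elems F₁))

floorSumAux : ℕ → ℕ → ℕ
floorSumAux n zero = 0
floorSumAux n (suc k) = n / suc k + floorSumAux n k

floorSum : ℕ → ℕ
floorSum n = floorSumAux n n

-- A uniquely determined set F₁ has no switching component, so its rows are nested: if row k′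
-- misses a column of row k, then row k′ is strictly shorter than row k.  Fix u ≥ 1, let A be
-- the rows of F₁ with at least u points, k* a shortest row in A and B the columns of row k*.
-- Nesting gives A × B ⊆ F₁ and puts no point of F₁ outside both the A-rows and the B-columns.
-- Comparing the line sums of F₁ and F₂ over A, B and their complements then shows that F₁
-- has at most α more points than F₂ in A × B, whence u·|A| ≤ |A × B| ≤ α + |F₁ ∩ F₂|.
-- Summing these bounds over the layers u of the row sums r_k of F₁ (each r_k ≤ α + p) gives
-- |F₁| = Σ_{u=1}^{α+p} #{k : r_k ≥ u} ≤ Σ_{u=1}^{α+p} ⌊(α+p)/u⌋.

module Submission where

open import Data.Bool using (Bool; true; false; T; not; _∧_; if_then_else_)
open import Data.Bool.Properties using (∧-assoc; ∧-zeroʳ; ∧-identityʳ; T-∧)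
open import Data.Empty using (⊥-elim)
open import Data.List using (List; []; _∷_; map; filter; length; _++_; deduplicate)
open import Data.List.Membership.Propositional using (_∈_; _∉_)
open import Data.List.Membership.Propositional.Properties
  using (∈-filter⁻; ∈-filter⁺; ∈-map⁺; ∈-deduplicate⁺; ∈-++⁺ˡ; ∈-++⁺ʳ)
open import Data.List.Properties using (filter-accept; filter-reject; filter-all)
open import Data.List.Relation.Unary.All as All using (All)
open import Data.List.Relation.Unary.AllPairs using (_∷_)
open import Data.List.Relation.Unary.Any using (here; there)
open import Data.List.Relation.Unary.Unique.Propositional using (Unique)
open import Data.List.Relation.Unary.Unique.Propositional.Properties using (filter⁺)
open import Data.Nat using (ℕ; zero; suc; _+_; _*_; _≤_; _<_; z≤n; s≤s; ∣_-_∣; _⊓_; _/_; _≤ᵇ_; _≤?_)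
open import Data.Nat.DivMod using (m*n/n≡m; /-monoˡ-≤)
open import Data.Nat.ListAction using (sum)
open import Data.Nat.Properties
open import Data.Nat.Tactic.RingSolver using (solve)
open import Algebra.Properties.CommutativeSemigroup +-commutativeSemigroup using (interchange; x∙yz≈y∙xz)
open import Data.List.Extrema ≤-totalOrder using (argmin; argmin-sel; f[argmin]≤f[xs])
open import Data.Product using (∃; _×_; _,_; proj₁; proj₂)
open import Data.Sum using (inj₁; inj₂)
open import Function using (_∘_; mk⇔; Equivalence)
open import Relation.Binary.Definitions using (DecidableEquality)
open import Relation.Binary.PropositionalEquality
open import Relation.Nullary using (Dec; yes; no; does; ¬_)
open import Relation.Nullary.Decidable using (T?; ¬?; _×-dec_; dec-true; dec-false; does-⇔)
open import Relation.Unary using (Decidable)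

open import Defs

module _ {B : Set} where

  sum-map-cong : ∀ {f g : B → ℕ} xs → (∀ x → x ∈ xs → f x ≡ g x) →
                 sum (map f xs) ≡ sum (map g xs)
  sum-map-cong []       f≡g = refl
  sum-map-cong (x ∷ xs) f≡g = cong₂ _+_ (f≡g x (here refl)) (sum-map-cong xs (λ y → f≡g y ∘ there))

  sum-map-mono : ∀ {f g : B → ℕ} xs → (∀ x → x ∈ xs → f x ≤ g x) →
                 sum (map f xs) ≤ sum (map g xs)
  sum-map-mono []       f≤g = z≤n
  sum-map-mono (x ∷ xs) f≤g = +-mono-≤ (f≤g x (here refl)) (sum-map-mono xs (λ y → f≤g y ∘ there))

  sum-map-mono-< : ∀ {f g : B → ℕ} xs {y} → y ∈ xs → (∀ x → x ∈ xs → f x ≤ g x) → f y < g y →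
                   sum (map f xs) < sum (map g xs)
  sum-map-mono-< (x ∷ xs) (here refl) f≤g fy<gy =
    +-mono-<-≤ fy<gy (sum-map-mono xs (λ z → f≤g z ∘ there))
  sum-map-mono-< (x ∷ xs) (there y∈) f≤g fy<gy =
    +-mono-≤-< (f≤g x (here refl)) (sum-map-mono-< xs y∈ (λ z → f≤g z ∘ there) fy<gy)

  sum-map-zero : ∀ {f : B → ℕ} xs → (∀ x → x ∈ xs → f x ≡ 0) → sum (map f xs) ≡ 0
  sum-map-zero []       f≡0 = refl
  sum-map-zero (x ∷ xs) f≡0 rewrite f≡0 x (here refl) = sum-map-zero xs (λ y → f≡0 y ∘ there)

  sum-map-+ : ∀ (f g : B → ℕ) xs → sum (map (λ x → f x + g x) xs) ≡ sum (map f xs) + sum (map g xs)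
  sum-map-+ f g []       = refl
  sum-map-+ f g (x ∷ xs) = trans (cong (f x + g x +_) (sum-map-+ f g xs))
                                 (interchange (f x) (g x) _ _)

  sum-map-if-split : ∀ (a : B → Bool) (f : B → ℕ) xs →
    sum (map f xs) ≡ sum (map (λ x → if a x then f x else 0) xs)
                   + sum (map (λ x → if not (a x) then f x else 0) xs)
  sum-map-if-split a f xs = trans (sum-map-cong xs (λ x _ → split (a x) (f x))) (sum-map-+ _ _ xs)
    where
    split : ∀ b n → n ≡ (if b then n else 0) + (if not b then n else 0)
    split true  n = sym (+-identityʳ n)
    split false n = refl

toℕ : Bool → ℕ
toℕ b = if b then 1 else 0

toℕ-mono : ∀ {a b} → (T a → T b) → toℕ a ≤ toℕ b
toℕ-mono {false}         a⇒b = z≤n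
toℕ-mono {true}  {true}  a⇒b = ≤-refl
toℕ-mono {true}  {false} a⇒b = ⊥-elim (a⇒b _)

if-≤ : ∀ b {m n} → (T b → m ≤ n) → (if b then m else 0) ≤ n
if-≤ true  m≤n = m≤n _
if-≤ false _   = z≤n

T-not⁻ : ∀ {b} → T (not b) → ¬ T b
T-not⁻ {false} _ ()

module _ {P : Set} where

  T-does⁺ : (P? : Dec P) → P → T (does P?)
  T-does⁺ (yes _) _ = _
  T-does⁺ (no ¬p) p = ¬p p

  T-does⁻ : (P? : Dec P) → T (does P?) → P
  T-does⁻ (yes p) _ = p

module _ {A : Set} where

  count : (A → Bool) → List A → ℕ
  count p xs = sum (map (toℕ ∘ p) xs)

  count-cong : ∀ {p q : A → Bool} xs → (∀ x → x ∈ xs → p x ≡ q x) → count p xs ≡ count q xs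
  count-cong xs p≡q = sum-map-cong xs (λ x x∈ → cong toℕ (p≡q x x∈))

  count-zero : ∀ {p : A → Bool} xs → (∀ x → x ∈ xs → ¬ T (p x)) → count p xs ≡ 0
  count-zero xs ¬p = sum-map-zero xs (λ x x∈ → ¬T⇒toℕ≡0 (¬p x x∈))
    where
    ¬T⇒toℕ≡0 : ∀ {b} → ¬ T b → toℕ b ≡ 0
    ¬T⇒toℕ≡0 {false} _  = refl
    ¬T⇒toℕ≡0 {true}  ¬b = ⊥-elim (¬b _)

  count-pos : ∀ {p : A → Bool} {x} xs → x ∈ xs → T (p x) → 1 ≤ count p xs
  count-pos (y ∷ xs) (here refl) py = ≤-trans (toℕ-mono {true} (λ _ → py)) (m≤m+n _ _)
  count-pos (y ∷ xs) (there x∈)  px = ≤-trans (count-pos xs x∈ px) (m≤n+m _ _)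

  count-witness : ∀ {p : A → Bool} xs → 1 ≤ count p xs → ∃ λ x → x ∈ xs × T (p x)
  count-witness {p} (x ∷ xs) 1≤ with p x in px
  ... | true  = x , here refl , subst T (sym px) _
  ... | false with count-witness xs 1≤
  ...   | y , y∈ , py = y , there y∈ , py

  count-const-true : ∀ xs → length xs ≡ count (λ _ → true) xs
  count-const-true []       = refl
  count-const-true (x ∷ xs) = cong suc (count-const-true xs)

  length-filter : ∀ {P : A → Set} (P? : Decidable P) xs → length (filter P? xs) ≡ count (does ∘ P?) xs
  length-filter P? []       = refl
  length-filter P? (x ∷ xs) with does (P? x)
  ... | true  = cong suc (length-filter P? xs)
  ... | false = length-filter P? xs

  count-if-const : ∀ (a : A → Bool) c xs → sum (map (λ x → if a x then c else 0) xs) ≡ count a xs * c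
  count-if-const a c []       = refl
  count-if-const a c (x ∷ xs) with a x
  ... | true  = cong (c +_) (count-if-const a c xs)
  ... | false = count-if-const a c xs

  count-+-pointwise : ∀ {p q r t : A → Bool} xs →
    (∀ x → toℕ (p x) + toℕ (q x) ≡ toℕ (r x) + toℕ (t x)) →
    count p xs + count q xs ≡ count r xs + count t xs
  count-+-pointwise {p} {q} {r} {t} xs pq≡rt = begin
    count p xs + count q xs                       ≡⟨ sum-map-+ (toℕ ∘ p) (toℕ ∘ q) xs ⟨
    sum (map (λ x → toℕ (p x) + toℕ (q x)) xs)    ≡⟨ sum-map-cong xs (λ x _ → pq≡rt x) ⟩
    sum (map (λ x → toℕ (r x) + toℕ (t x)) xs)    ≡⟨ sum-map-+ (toℕ ∘ r) (toℕ ∘ t) xs ⟩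
    count r xs + count t xs                       ∎
    where open ≡-Reasoning

  count-minimal : ∀ (f : A → ℕ) {p : A → Bool} xs → 1 ≤ count p xs →
    ∃ λ m → m ∈ xs × T (p m) × (∀ x → x ∈ xs → T (p x) → f m ≤ f x)
  count-minimal f {p} xs 1≤ = m , proj₁ m∈xs×pm , proj₂ m∈xs×pm , minimal
    where
    witness : ∃ λ x → x ∈ xs × T (p x)
    witness = count-witness xs 1≤
    x₀ : A
    x₀ = proj₁ witness
    candidates : List A
    candidates = filter (λ x → T? (p x)) xs
    m : A
    m = argmin f x₀ candidates
    m∈xs×pm : m ∈ xs × T (p m)
    m∈xs×pm with argmin-sel f x₀ candidates
    ... | inj₁ m≡x₀ = subst (λ z → z ∈ xs × T (p z)) (sym m≡x₀) (proj₂ witness)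
    ... | inj₂ m∈   = ∈-filter⁻ (λ x → T? (p x)) m∈
    minimal : ∀ x → x ∈ xs → T (p x) → f m ≤ f x
    minimal x x∈ px = All.lookup (f[argmin]≤f[xs] x₀ candidates) (∈-filter⁺ (λ x → T? (p x)) x∈ px)

module _ {A : Set} (_≟_ : DecidableEquality A) where

  open import Data.List.Membership.DecPropositional _≟_ using (_∈?_)

  remove : A → List A → List A
  remove x = filter (λ y → ¬? (x ≟ y))

  count-remove : ∀ (p : A → Bool) {x} xs → Unique xs → x ∈ xs →
                 count p xs ≡ toℕ (p x) + count p (remove x xs)
  count-remove p {x} (x ∷ xs) (x∉xs ∷ _) (here refl) =
    cong (λ ys → toℕ (p x) + count p ys)
         (sym (trans (filter-reject (λ y → ¬? (x ≟ y)) (λ x≢x → x≢x refl))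
                     (filter-all (λ y → ¬? (x ≟ y)) x∉xs)))
  count-remove p {x} (y ∷ xs) (y∉xs ∷ u) (there x∈xs) = begin
    toℕ (p y) + count p xs
      ≡⟨ cong (toℕ (p y) +_) (count-remove p xs u x∈xs) ⟩
    toℕ (p y) + (toℕ (p x) + count p (remove x xs))
      ≡⟨ x∙yz≈y∙xz (toℕ (p y)) (toℕ (p x)) _ ⟩
    toℕ (p x) + count p (y ∷ remove x xs)
      ≡⟨ cong (λ ys → toℕ (p x) + count p ys)
              (filter-accept (λ z → ¬? (x ≟ z)) (≢-sym (All.lookup y∉xs x∈xs))) ⟨
    toℕ (p x) + count p (remove x (y ∷ xs))
      ∎
    where open ≡-Reasoning

  count-point∈ : ∀ (p : A → Bool) {x} xs → Unique xs → x ∈ xs →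
                 count (λ y → p y ∧ does (y ≟ x)) xs ≡ toℕ (p x)
  count-point∈ p {x} xs u x∈xs = begin
    count (λ y → p y ∧ does (y ≟ x)) xs
      ≡⟨ count-remove _ xs u x∈xs ⟩
    toℕ (p x ∧ does (x ≟ x)) + count (λ y → p y ∧ does (y ≟ x)) (remove x xs)
      ≡⟨ cong₂ _+_ selfTerm removedTerm ⟩
    toℕ (p x) + 0
      ≡⟨ +-identityʳ _ ⟩
    toℕ (p x)
      ∎
    where
    open ≡-Reasoning
    selfTerm : toℕ (p x ∧ does (x ≟ x)) ≡ toℕ (p x)
    selfTerm rewrite dec-true (x ≟ x) refl | ∧-identityʳ (p x) = refl
    removedTerm : count (λ y → p y ∧ does (y ≟ x)) (remove x xs) ≡ 0
    removedTerm = count-zero (remove x xs) λ y y∈ pyx →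
      proj₂ (∈-filter⁻ (λ z → ¬? (x ≟ z)) {xs = xs} y∈)
            (sym (T-does⁻ (y ≟ x) (proj₂ (Equivalence.to T-∧ pyx))))

  count-point : ∀ (p : A → Bool) x xs → Unique xs →
                count (λ y → p y ∧ does (y ≟ x)) xs ≡ toℕ (p x ∧ does (x ∈? xs))
  count-point p x xs u with x ∈? xs
  ... | yes x∈xs = trans (count-point∈ p xs u x∈xs) (cong toℕ (sym (∧-identityʳ (p x))))
  ... | no  x∉xs = trans (count-zero xs notHere) (cong toℕ (sym (∧-zeroʳ (p x))))
    where
    notHere : ∀ y → y ∈ xs → ¬ T (p y ∧ does (y ≟ x))
    notHere y y∈ pyx = x∉xs (subst (_∈ xs) (T-does⁻ (y ≟ x) (proj₂ (Equivalence.to T-∧ pyx))) y∈)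

module _ {A B : Set} (_≟_ : DecidableEquality B) (g : A → B) where

  count-fibres : ∀ (p : A → Bool) {I} → Unique I → ∀ xs → (∀ x → x ∈ xs → T (p x) → g x ∈ I) →
                 count p xs ≡ sum (map (λ k → count (λ x → p x ∧ does (g x ≟ k)) xs) I)
  count-fibres p {I} uI []       covered = sym (sum-map-zero I (λ _ _ → refl))
  count-fibres p {I} uI (x ∷ xs) covered =
    trans (cong₂ _+_ (fibreOf (p x) refl) (count-fibres p uI xs (λ y → covered y ∘ there)))
          (sym (sum-map-+ _ _ I))
    where
    fibreOf : ∀ b → p x ≡ b → toℕ b ≡ sum (map (λ k → toℕ (b ∧ does (g x ≟ k))) I)
    fibreOf false _  = sym (sum-map-zero I (λ _ _ → refl))
    fibreOf true  px = sym (trans (count-cong I (λ k _ → does-⇔ (mk⇔ sym sym) (g x ≟ k) (k ≟ g x)))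
                                  (count-point∈ _≟_ (λ _ → true) I uI
                                                (covered x (here refl) (subst T (sym px) _))))

  fibreSize : List A → B → ℕ
  fibreSize xs k = length (filter (λ x → g x ≟ k) xs)

  count-∘-fibres : ∀ (a : B → Bool) {I} → Unique I → ∀ xs → (∀ x → x ∈ xs → g x ∈ I) →
                   count (a ∘ g) xs ≡ sum (map (λ k → if a k then fibreSize xs k else 0) I)
  count-∘-fibres a {I} uI xs covered =
    trans (count-fibres (a ∘ g) uI xs (λ x x∈ _ → covered x x∈)) (sum-map-cong I (λ k _ → fibre k))
    where
    fibre : ∀ k → count (λ x → a (g x) ∧ does (g x ≟ k)) xs ≡ (if a k then fibreSize xs k else 0)
    fibre k = trans (count-cong xs (λ x _ → onFibre x)) (constantly (a k))
      where
      onFibre : ∀ x → a (g x) ∧ does (g x ≟ k) ≡ a k ∧ does (g x ≟ k)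
      onFibre x with g x ≟ k
      ... | yes gx≡k = cong (λ c → a c ∧ true) gx≡k
      ... | no  _    = trans (∧-zeroʳ _) (sym (∧-zeroʳ _))
      constantly : ∀ b → count (λ x → b ∧ does (g x ≟ k)) xs ≡ (if b then fibreSize xs k else 0)
      constantly true  = sym (length-filter (λ x → g x ≟ k) xs)
      constantly false = sum-map-zero xs (λ _ _ → refl)

  fibreError : List B → List A → List A → (B → Bool) → ℕ
  fibreError I xs ys a = sum (map (λ k → if a k then ∣ fibreSize xs k - fibreSize ys k ∣ else 0) I)

  fibreError-comm : ∀ I xs ys a → fibreError I xs ys a ≡ fibreError I ys xs a
  fibreError-comm I xs ys a =
    sum-map-cong I (λ k _ → cong (λ d → if a k then d else 0) (∣-∣-comm (fibreSize xs k) (fibreSize ys k)))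

  count-∘-≤ : ∀ (a : B → Bool) {I} → Unique I → ∀ xs ys →
              (∀ x → x ∈ xs → g x ∈ I) → (∀ y → y ∈ ys → g y ∈ I) →
              count (a ∘ g) xs ≤ count (a ∘ g) ys + fibreError I xs ys a
  count-∘-≤ a {I} uI xs ys xs⊆I ys⊆I = begin
    count (a ∘ g) xs
      ≡⟨ count-∘-fibres a uI xs xs⊆I ⟩
    sum (map (λ k → if a k then fibreSize xs k else 0) I)
      ≤⟨ sum-map-mono I (λ k _ → fibreBound (a k)) ⟩
    sum (map (λ k → (if a k then fibreSize ys k else 0)
                  + (if a k then ∣ fibreSize xs k - fibreSize ys k ∣ else 0)) I)
      ≡⟨ sum-map-+ _ _ I ⟩
    sum (map (λ k → if a k then fibreSize ys k else 0) I) + fibreError I xs ys a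
      ≡⟨ cong (_+ fibreError I xs ys a) (count-∘-fibres a uI ys ys⊆I) ⟨
    count (a ∘ g) ys + fibreError I xs ys a
      ∎
    where
    open ≤-Reasoning
    fibreBound : ∀ b {m n} → (if b then m else 0) ≤ (if b then n else 0) + (if b then ∣ m - n ∣ else 0)
    fibreBound true  {m} {n} = ≤-trans (m≤n+m∸n m n) (+-monoʳ-≤ n (m∸n≤∣m-n∣ m n))
    fibreBound false         = z≤n

module _ {A : Set} (_≟_ : DecidableEquality A) where

  open import Data.List.Membership.DecPropositional _≟_ using (_∈?_)

  count-≤-intersection : ∀ {p : A → Bool} xs ys → Unique xs → Unique ys →
                         (∀ y → y ∈ ys → T (p y) → y ∈ xs) →
                         count p ys ≤ count (λ x → does (x ∈? ys)) xs
  count-≤-intersection {p} xs ys uxs uys ys⊆xs = begin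
    count p ys
      ≡⟨ count-fibres _≟_ (λ y → y) p uxs ys ys⊆xs ⟩
    sum (map (λ x → count (λ y → p y ∧ does (y ≟ x)) ys) xs)
      ≡⟨ sum-map-cong xs (λ x _ → count-point _≟_ p x ys uys) ⟩
    sum (map (λ x → toℕ (p x ∧ does (x ∈? ys))) xs)
      ≤⟨ sum-map-mono xs (λ x _ → toℕ-mono (proj₂ ∘ Equivalence.to T-∧)) ⟩
    count (λ x → does (x ∈? ys)) xs
      ∎
    where open ≤-Reasoning

-- Layer-cake bound by floor sums

module _ {B : Set} (s : B → ℕ) (xs : List B) where

  atLeast : ℕ → ℕ
  atLeast u = count (λ x → u ≤ᵇ s x) xs

  private
    ⊓-suc : ∀ m k → m ⊓ suc k ≡ toℕ (suc k ≤ᵇ m) + m ⊓ k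
    ⊓-suc m k with suc k ≤ᵇ m in test
    ... | true  = trans (m≥n⇒m⊓n≡n k<m) (cong suc (sym (m≥n⇒m⊓n≡n (<⇒≤ k<m))))
      where
      k<m : k < m
      k<m = ≤ᵇ⇒≤ (suc k) m (subst T (sym test) _)
    ... | false = trans (m≤n⇒m⊓n≡m (m≤n⇒m≤1+n m≤k)) (sym (m≤n⇒m⊓n≡m m≤k))
      where
      m≤k : m ≤ k
      m≤k = ≮⇒≥ (λ k<m → subst T test (≤⇒≤ᵇ k<m))

  module _ (n : ℕ) (layers≤ : ∀ u → 1 ≤ u → u * atLeast u ≤ n) where

    atLeast-≤-/ : ∀ k → atLeast (suc k) ≤ n / suc k
    atLeast-≤-/ k = begin
      atLeast (suc k)                  ≡⟨ m*n/n≡m (atLeast (suc k)) (suc k) ⟨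
      atLeast (suc k) * suc k / suc k  ≤⟨ /-monoˡ-≤ (suc k) (subst (_≤ n) (*-comm (suc k) _) layer) ⟩
      n / suc k                        ∎
      where
      open ≤-Reasoning
      layer : suc k * atLeast (suc k) ≤ n
      layer = layers≤ (suc k) (s≤s z≤n)

    sum-⊓-≤-floorSumAux : ∀ k → sum (map (λ x → s x ⊓ k) xs) ≤ floorSumAux n k
    sum-⊓-≤-floorSumAux zero    = ≤-reflexive (sum-map-zero xs (λ x _ → ⊓-zeroʳ (s x)))
    sum-⊓-≤-floorSumAux (suc k) = begin
      sum (map (λ x → s x ⊓ suc k) xs)
        ≡⟨ sum-map-cong xs (λ x _ → ⊓-suc (s x) k) ⟩
      sum (map (λ x → toℕ (suc k ≤ᵇ s x) + s x ⊓ k) xs)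
        ≡⟨ sum-map-+ _ _ xs ⟩
      atLeast (suc k) + sum (map (λ x → s x ⊓ k) xs)
        ≤⟨ +-mono-≤ (atLeast-≤-/ k) (sum-⊓-≤-floorSumAux k) ⟩
      n / suc k + floorSumAux n k
        ∎
      where open ≤-Reasoning

    s≤n : ∀ x → x ∈ xs → s x ≤ n
    s≤n x x∈ = ≮⇒≥ λ n<sx → <⇒≱ (n<1+n n) (begin
      suc n                   ≡⟨ *-identityʳ (suc n) ⟨
      suc n * 1               ≤⟨ *-monoʳ-≤ (suc n) (count-pos xs x∈ (≤⇒≤ᵇ n<sx)) ⟩
      suc n * atLeast (suc n) ≤⟨ layers≤ (suc n) (s≤s z≤n) ⟩
      n                       ∎)
      where open ≤-Reasoning

    sum-≤-floorSum : sum (map s xs) ≤ floorSum n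
    sum-≤-floorSum = begin
      sum (map s xs)                   ≡⟨ sum-map-cong xs (λ x x∈ → sym (m≤n⇒m⊓n≡m (s≤n x x∈))) ⟩
      sum (map (λ x → s x ⊓ n) xs)     ≤⟨ sum-⊓-≤-floorSumAux n ⟩
      floorSum n                       ∎
      where open ≤-Reasoning

open import Data.Integer using (ℤ) renaming (_≟_ to _≟ℤ_)
open import Data.List.Membership.DecPropositional _≟P_ using (_∈?_)
open import Data.List.Relation.Unary.Unique.DecPropositional.Properties _≟ℤ_ using (deduplicate-!)

-- Switching components

module Switch (F : FinSet) {k l k′ l′ : ℤ}
  (kl∈F : (k , l) ∈ elems F) (k′l′∈F : (k′ , l′) ∈ elems F)
  (kl′∉F : (k , l′) ∉ elems F) (k′l∉F : (k′ , l) ∉ elems F) where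

  private
    L : List Point
    L = elems F

    kl≢k′l′ : (k , l) ≢ (k′ , l′)
    kl≢k′l′ eq = kl′∉F (subst (λ z → (k , z) ∈ L) (cong proj₂ eq) kl∈F)

    kl′≢k′l : (k , l′) ≢ (k′ , l)
    kl′≢k′l eq = kl′∉F (subst (λ z → (k , z) ∈ L) (sym (cong proj₂ eq)) kl∈F)

    without-kl : List Point
    without-kl = remove _≟P_ (k , l) L

  rest : List Point
  rest = remove _≟P_ (k′ , l′) without-kl

  private
    rest⊆L : ∀ {q} → q ∈ rest → q ∈ L
    rest⊆L q∈ = proj₁ (∈-filter⁻ (λ z → ¬? ((k , l) ≟P z)) {xs = L}
                        (proj₁ (∈-filter⁻ (λ z → ¬? ((k′ , l′) ≟P z)) {xs = without-kl} q∈)))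

    ∉rest : ∀ {q} → q ∉ L → All (q ≢_) rest
    ∉rest q∉L = All.tabulate (λ z∈ q≡z → q∉L (subst (_∈ L) (sym q≡z) (rest⊆L z∈)))

    unique-without-kl : Unique without-kl
    unique-without-kl = filter⁺ (λ z → ¬? ((k , l) ≟P z)) (unique F)

  switched : FinSet
  switched = finSet ((k , l′) ∷ (k′ , l) ∷ rest)
    ( (kl′≢k′l All.∷ ∉rest kl′∉F)
    ∷ ∉rest k′l∉F
    ∷ filter⁺ (λ z → ¬? ((k′ , l′) ≟P z)) unique-without-kl)

  count-via-rest : ∀ R → count R L ≡ toℕ (R (k , l)) + (toℕ (R (k′ , l′)) + count R rest)
  count-via-rest R =
    trans (count-remove _≟P_ R L (unique F) kl∈F)
          (cong (toℕ (R (k , l)) +_)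
                (count-remove _≟P_ R without-kl unique-without-kl
                              (∈-filter⁺ (λ z → ¬? ((k , l) ≟P z)) k′l′∈F kl≢k′l′)))

  rowSum-switched : ∀ i → rowSum switched i ≡ rowSum F i
  rowSum-switched i = begin
    rowSum switched i             ≡⟨ length-filter (λ q → proj₁ q ≟ℤ i) (elems switched) ⟩
    count inRow (elems switched)  ≡⟨ count-via-rest inRow ⟨
    count inRow L                 ≡⟨ length-filter (λ q → proj₁ q ≟ℤ i) L ⟨
    rowSum F i                    ∎
    where
    open ≡-Reasoning
    inRow : Point → Bool
    inRow q = does (proj₁ q ≟ℤ i)

  colSum-switched : ∀ j → colSum switched j ≡ colSum F j
  colSum-switched j = begin
    colSum switched j
      ≡⟨ length-filter (λ q → proj₂ q ≟ℤ j) (elems switched) ⟩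
    count inCol (elems switched)
      ≡⟨ x∙yz≈y∙xz (toℕ (inCol (k , l′))) (toℕ (inCol (k′ , l))) _ ⟩
    toℕ (inCol (k , l)) + (toℕ (inCol (k′ , l′)) + count inCol rest)
      ≡⟨ count-via-rest inCol ⟨
    count inCol L
      ≡⟨ length-filter (λ q → proj₂ q ≟ℤ j) L ⟨
    colSum F j
      ∎
    where
    open ≡-Reasoning
    inCol : Point → Bool
    inCol q = does (proj₂ q ≟ℤ j)

noSwitchingComponent : ∀ F → UniquelyDetermined F → ∀ {k l k′ l′} →
  (k , l) ∈ elems F → (k′ , l′) ∈ elems F → (k′ , l) ∉ elems F → (k , l′) ∈ elems F
noSwitchingComponent F ud {k} {l} {k′} {l′} kl∈F k′l′∈F k′l∉F with (k , l′) ∈? elems F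
... | yes kl′∈F = kl′∈F
... | no  kl′∉F =
  ⊥-elim (kl′∉F (Equivalence.to (ud switched rowSum-switched colSum-switched (k , l′)) (here refl)))
  where open Switch F kl∈F k′l′∈F kl′∉F k′l∉F

-- Line sums of two finite sets

count-grid : ∀ {I J} → Unique I → Unique J → ∀ (F : FinSet) →
  (∀ q → q ∈ elems F → proj₁ q ∈ I) → (∀ q → q ∈ elems F → proj₂ q ∈ J) →
  ∀ (p : Point → Bool) →
  count p (elems F)
    ≡ sum (map (λ k → sum (map (λ l → toℕ (p (k , l) ∧ does ((k , l) ∈? elems F))) J)) I)
count-grid {I} {J} uI uJ F F⊆I F⊆J p = begin
  count p L
    ≡⟨ count-fibres _≟ℤ_ proj₁ p uI L (λ q q∈ _ → F⊆I q q∈) ⟩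
  sum (map (λ k → count (λ q → p q ∧ does (proj₁ q ≟ℤ k)) L) I)
    ≡⟨ sum-map-cong I (λ k _ → count-fibres _≟ℤ_ proj₂ _ uJ L (λ q q∈ _ → F⊆J q q∈)) ⟩
  sum (map (λ k → sum (map (λ l →
    count (λ q → (p q ∧ does (proj₁ q ≟ℤ k)) ∧ does (proj₂ q ≟ℤ l)) L) J)) I)
    ≡⟨ sum-map-cong I (λ k _ → sum-map-cong J (λ l _ → cell k l)) ⟩
  sum (map (λ k → sum (map (λ l → toℕ (p (k , l) ∧ does ((k , l) ∈? L))) J)) I) ∎
  where
  open ≡-Reasoning
  L : List Point
  L = elems F
  cell : ∀ k l → count (λ q → (p q ∧ does (proj₁ q ≟ℤ k)) ∧ does (proj₂ q ≟ℤ l)) L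
               ≡ toℕ (p (k , l) ∧ does ((k , l) ∈? L))
  cell k l = trans (count-cong L λ q _ → trans (∧-assoc (p q) _ _) (cong (p q ∧_) (coordinatewise q)))
                   (count-point _≟P_ p (k , l) L (unique F))
    where
    coordinatewise : ∀ q → does ((proj₁ q ≟ℤ k) ×-dec (proj₂ q ≟ℤ l)) ≡ does (q ≟P (k , l))
    coordinatewise q = does-⇔ (mk⇔ (λ { (refl , refl) → refl }) (λ { refl → refl , refl }))
                                ((proj₁ q ≟ℤ k) ×-dec (proj₂ q ≟ℤ l)) (q ≟P (k , l))

≤-transfer : ∀ {p₁ x₁ y₁ z₁ p₂ x₂ y₂ z₂ e f} →
  p₁ + x₁ ≡ y₁ + z₁ → p₂ + x₂ ≡ y₂ + z₂ → y₁ ≤ y₂ + e → x₂ ≤ x₁ + f →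
  p₁ + z₂ ≤ p₂ + z₁ + (e + f)
≤-transfer {p₁} {x₁} {y₁} {z₁} {p₂} {x₂} {y₂} {z₂} {e} {f} eq₁ eq₂ y₁≤ x₂≤ =
  +-cancelʳ-≤ (x₁ + y₂) _ _ (begin
    p₁ + z₂ + (x₁ + y₂)             ≡⟨ solve (p₁ ∷ z₂ ∷ x₁ ∷ y₂ ∷ []) ⟩
    (p₁ + x₁) + (y₂ + z₂)           ≡⟨ cong₂ _+_ eq₁ (sym eq₂) ⟩
    (y₁ + z₁) + (p₂ + x₂)           ≤⟨ +-mono-≤ (+-monoˡ-≤ z₁ y₁≤) (+-monoʳ-≤ p₂ x₂≤) ⟩
    (y₂ + e + z₁) + (p₂ + (x₁ + f)) ≡⟨ solve (y₂ ∷ e ∷ z₁ ∷ p₂ ∷ x₁ ∷ f ∷ []) ⟩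
    p₂ + z₁ + (e + f) + (x₁ + y₂)   ∎)
  where open ≤-Reasoning

≤-average : ∀ {w v e₁ e₂} α → w ≤ v + e₁ → w ≤ v + e₂ → e₁ + e₂ ≡ 2 * α → w ≤ v + α
≤-average {w} {v} {e₁} {e₂} α w≤₁ w≤₂ e₁+e₂≡ = *-cancelˡ-≤ 2 (begin
  2 * w                   ≡⟨ solve (w ∷ []) ⟩
  w + w                   ≤⟨ +-mono-≤ w≤₁ w≤₂ ⟩
  (v + e₁) + (v + e₂)     ≡⟨ solve (v ∷ e₁ ∷ e₂ ∷ []) ⟩
  2 * v + (e₁ + e₂)       ≡⟨ cong (2 * v +_) e₁+e₂≡ ⟩
  2 * v + 2 * α           ≡⟨ solve (v ∷ α ∷ []) ⟩
  2 * (v + α)             ∎)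
  where open ≤-Reasoning

module LineSums (F₁ F₂ : FinSet) where

  L₁ L₂ : List Point
  L₁ = elems F₁
  L₂ = elems F₂

  rows columns : List ℤ
  rows    = deduplicate _≟ℤ_ (map proj₁ (L₁ ++ L₂))
  columns = deduplicate _≟ℤ_ (map proj₂ (L₁ ++ L₂))

  unique-rows : Unique rows
  unique-rows = deduplicate-! (map proj₁ (L₁ ++ L₂))

  unique-columns : Unique columns
  unique-columns = deduplicate-! (map proj₂ (L₁ ++ L₂))

  private
    ∈-rows : ∀ {q} → q ∈ L₁ ++ L₂ → proj₁ q ∈ rows
    ∈-rows q∈ = ∈-deduplicate⁺ _≟ℤ_ (∈-map⁺ proj₁ q∈)

    ∈-columns : ∀ {q} → q ∈ L₁ ++ L₂ → proj₂ q ∈ columns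
    ∈-columns q∈ = ∈-deduplicate⁺ _≟ℤ_ (∈-map⁺ proj₂ q∈)

  L₁⊆rows : ∀ q → q ∈ L₁ → proj₁ q ∈ rows
  L₁⊆rows _ = ∈-rows ∘ ∈-++⁺ˡ

  L₂⊆rows : ∀ q → q ∈ L₂ → proj₁ q ∈ rows
  L₂⊆rows _ = ∈-rows ∘ ∈-++⁺ʳ L₁

  L₁⊆columns : ∀ q → q ∈ L₁ → proj₂ q ∈ columns
  L₁⊆columns _ = ∈-columns ∘ ∈-++⁺ˡ

  L₂⊆columns : ∀ q → q ∈ L₂ → proj₂ q ∈ columns
  L₂⊆columns _ = ∈-columns ∘ ∈-++⁺ʳ L₁

  rowError colError : (ℤ → Bool) → ℕ
  rowError = fibreError _≟ℤ_ proj₁ rows L₁ L₂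
  colError = fibreError _≟ℤ_ proj₂ columns L₁ L₂

  lineSumError-split : ∀ a b →
    lineSumError F₁ F₂ ≡ (colError b + colError (not ∘ b)) + (rowError a + rowError (not ∘ a))
  lineSumError-split a b = cong₂ _+_ (sum-map-if-split b _ columns) (sum-map-if-split a _ rows)

  rows-≤ : ∀ a → count (a ∘ proj₁) L₁ ≤ count (a ∘ proj₁) L₂ + rowError a
  rows-≤ a = count-∘-≤ _≟ℤ_ proj₁ a unique-rows L₁ L₂ L₁⊆rows L₂⊆rows

  rows-≥ : ∀ a → count (a ∘ proj₁) L₂ ≤ count (a ∘ proj₁) L₁ + rowError a
  rows-≥ a = subst (λ e → count (a ∘ proj₁) L₂ ≤ count (a ∘ proj₁) L₁ + e)
                   (fibreError-comm _≟ℤ_ proj₁ rows L₂ L₁ a)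
                   (count-∘-≤ _≟ℤ_ proj₁ a unique-rows L₂ L₁ L₂⊆rows L₁⊆rows)

  columns-≤ : ∀ b → count (b ∘ proj₂) L₁ ≤ count (b ∘ proj₂) L₂ + colError b
  columns-≤ b = count-∘-≤ _≟ℤ_ proj₂ b unique-columns L₁ L₂ L₁⊆columns L₂⊆columns

  columns-≥ : ∀ b → count (b ∘ proj₂) L₂ ≤ count (b ∘ proj₂) L₁ + colError b
  columns-≥ b = subst (λ e → count (b ∘ proj₂) L₂ ≤ count (b ∘ proj₂) L₁ + e)
                      (fibreError-comm _≟ℤ_ proj₂ columns L₂ L₁ b)
                      (count-∘-≤ _≟ℤ_ proj₂ b unique-columns L₂ L₁ L₂⊆columns L₁⊆columns)

  inRect offRect : (ℤ → Bool) → (ℤ → Bool) → Point → Bool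
  inRect  a b q = a (proj₁ q) ∧ b (proj₂ q)
  offRect a b q = not (a (proj₁ q)) ∧ not (b (proj₂ q))

  module _ (a b : ℤ → Bool) where

    inRect+offColumns : ∀ L → count (inRect a b) L + count ((not ∘ b) ∘ proj₂) L
                            ≡ count (a ∘ proj₁) L + count (offRect a b) L
    inRect+offColumns L = count-+-pointwise L (λ q → table (a (proj₁ q)) (b (proj₂ q)))
      where
      table : ∀ x y → toℕ (x ∧ y) + toℕ (not y) ≡ toℕ x + toℕ (not x ∧ not y)
      table true  true  = refl
      table true  false = refl
      table false true  = refl
      table false false = refl

    inRect+offRows : ∀ L → count (inRect a b) L + count ((not ∘ a) ∘ proj₁) L
                         ≡ count (b ∘ proj₂) L + count (offRect a b) L
    inRect+offRows L = count-+-pointwise L (λ q → table (a (proj₁ q)) (b (proj₂ q)))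
      where
      table : ∀ x y → toℕ (x ∧ y) + toℕ (not x) ≡ toℕ y + toℕ (not x ∧ not y)
      table true  true  = refl
      table true  false = refl
      table false true  = refl
      table false false = refl

    -- The two ways of expressing the block counts through row and column counts bound the
    -- excess of F₁ over F₂ by complementary parts of the line-sum error, which add up to 2α.
    rectangle-bound : ∀ α → 2 * α ≡ lineSumError F₁ F₂ →
      count (inRect a b) L₁ + count (offRect a b) L₂ ≤ count (inRect a b) L₂ + count (offRect a b) L₁ + α
    rectangle-bound α 2α≡ =
      ≤-average {e₁ = rowError a + colError (not ∘ b)} {e₂ = colError b + rowError (not ∘ a)} α
        (≤-transfer {p₁ = P₁} {z₁ = Z₁} {p₂ = P₂} {z₂ = Z₂}
                    (inRect+offColumns L₁) (inRect+offColumns L₂) (rows-≤ a) (columns-≥ (not ∘ b)))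
        (≤-transfer {p₁ = P₁} {z₁ = Z₁} {p₂ = P₂} {z₂ = Z₂}
                    (inRect+offRows L₁) (inRect+offRows L₂) (columns-≤ b) (rows-≥ (not ∘ a)))
        (trans (regroup (rowError a) (colError (not ∘ b)) (colError b) (rowError (not ∘ a)))
               (trans (sym (lineSumError-split a b)) (sym 2α≡)))
      where
      P₁ Z₁ P₂ Z₂ : ℕ
      P₁ = count (inRect a b) L₁
      Z₁ = count (offRect a b) L₁
      P₂ = count (inRect a b) L₂
      Z₂ = count (offRect a b) L₂
      regroup : ∀ w x y z → (w + x) + (y + z) ≡ (y + x) + (w + z)
      regroup w x y z = solve (w ∷ x ∷ y ∷ z ∷ [])

-- Nested rows of a uniquely determined set

module NestedRows (F₁ F₂ : FinSet) (ud : UniquelyDetermined F₁) where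

  open LineSums F₁ F₂

  rowLength : ℤ → ℕ
  rowLength k = sum (map (λ l → toℕ (does ((k , l) ∈? L₁))) columns)

  ∣F₁∣≡sum-rowLength : ∣ F₁ ∣ ≡ sum (map rowLength rows)
  ∣F₁∣≡sum-rowLength = trans (count-const-true L₁)
    (count-grid unique-rows unique-columns F₁ L₁⊆rows L₁⊆columns (λ _ → true))

  rowLength-< : ∀ {k l k′} → (k , l) ∈ L₁ → (k′ , l) ∉ L₁ → rowLength k′ < rowLength k
  rowLength-< {k} {l} {k′} kl∈ k′l∉ = sum-map-mono-< columns (L₁⊆columns _ kl∈) row⊆row strict
    where
    row⊆row : ∀ l′ → l′ ∈ columns →
      toℕ (does ((k′ , l′) ∈? L₁)) ≤ toℕ (does ((k , l′) ∈? L₁))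
    row⊆row l′ _ = toℕ-mono λ k′l′∈ → T-does⁺ ((k , l′) ∈? L₁)
      (noSwitchingComponent F₁ ud kl∈ (T-does⁻ ((k′ , l′) ∈? L₁) k′l′∈) k′l∉)
    strict : toℕ (does ((k′ , l) ∈? L₁)) < toℕ (does ((k , l) ∈? L₁))
    strict rewrite dec-false ((k′ , l) ∈? L₁) k′l∉ | dec-true ((k , l) ∈? L₁) kl∈ = s≤s z≤n

  module ShortestTallRow (u : ℕ) (k* : ℤ) (u≤k* : u ≤ rowLength k*)
    (shortest : ∀ k → k ∈ rows → T (u ≤ᵇ rowLength k) → rowLength k* ≤ rowLength k) where

    tall : ℤ → Bool
    tall k = u ≤ᵇ rowLength k

    inShortestRow : ℤ → Bool
    inShortestRow l = does ((k* , l) ∈? L₁)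

    tall-row-⊇ : ∀ {k l} → k ∈ rows → T (tall k) → T (inShortestRow l) → (k , l) ∈ L₁
    tall-row-⊇ {k} {l} k∈ tk sl with (k , l) ∈? L₁
    ... | yes kl∈ = kl∈
    ... | no  kl∉ = ⊥-elim (<⇒≱ (rowLength-< (T-does⁻ ((k* , l) ∈? L₁) sl) kl∉) (shortest k k∈ tk))

    offRect-empty : count (offRect tall inShortestRow) L₁ ≡ 0
    offRect-empty = count-zero L₁ λ q q∈ t →
      let (short , off) = Equivalence.to T-∧ t
          k*l∉ = T-not⁻ off ∘ T-does⁺ ((k* , proj₂ q) ∈? L₁)
      in T-not⁻ short (≤⇒≤ᵇ (≤-trans u≤k* (<⇒≤ (rowLength-< q∈ k*l∉))))

    inRect-F₂ : count (inRect tall inShortestRow) L₂ ≤ interCard F₁ F₂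
    inRect-F₂ = ≤-trans
      (count-≤-intersection _≟P_ L₁ L₂ (unique F₁) (unique F₂) λ q q∈ t →
         let (tk , sl) = Equivalence.to T-∧ t in tall-row-⊇ (L₂⊆rows q q∈) tk sl)
      (≤-reflexive (sym (length-filter (λ q → q ∈? L₂) L₁)))

    inRect-F₁ : u * count tall rows ≤ count (inRect tall inShortestRow) L₁
    inRect-F₁ = begin
      u * count tall rows
        ≤⟨ *-monoˡ-≤ (count tall rows) u≤k* ⟩
      rowLength k* * count tall rows
        ≡⟨ *-comm (rowLength k*) _ ⟩
      count tall rows * rowLength k*
        ≡⟨ count-if-const tall (rowLength k*) rows ⟨
      sum (map (λ k → if tall k then rowLength k* else 0) rows)
        ≤⟨ sum-map-mono rows (λ k k∈ → if-≤ (tall k) (tallRow k∈)) ⟩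
      sum (map (λ k → sum (map (cell k) columns)) rows)
        ≡⟨ count-grid unique-rows unique-columns F₁ L₁⊆rows L₁⊆columns _ ⟨
      count (inRect tall inShortestRow) L₁
        ∎
      where
      open ≤-Reasoning
      cell : ℤ → ℤ → ℕ
      cell k l = toℕ ((tall k ∧ inShortestRow l) ∧ does ((k , l) ∈? L₁))
      tallRow : ∀ {k} → k ∈ rows → T (tall k) → rowLength k* ≤ sum (map (cell k) columns)
      tallRow {k} k∈ tk = sum-map-mono columns λ l _ → toℕ-mono λ sl →
        Equivalence.from T-∧ ( Equivalence.from T-∧ (tk , sl)
                             , T-does⁺ ((k , l) ∈? L₁) (tall-row-⊇ k∈ tk sl))

    bound : ∀ α → 2 * α ≡ lineSumError F₁ F₂ → u * count tall rows ≤ α + interCard F₁ F₂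
    bound α 2α≡ = begin
      u * count tall rows  ≤⟨ inRect-F₁ ⟩
      P₁                   ≤⟨ m≤m+n P₁ O₂ ⟩
      P₁ + O₂              ≤⟨ rectangle-bound tall inShortestRow α 2α≡ ⟩
      P₂ + O₁ + α          ≡⟨ cong (λ z → P₂ + z + α) offRect-empty ⟩
      P₂ + 0 + α           ≤⟨ +-monoˡ-≤ α (≤-trans (≤-reflexive (+-identityʳ P₂)) inRect-F₂) ⟩
      interCard F₁ F₂ + α  ≡⟨ +-comm _ α ⟩
      α + interCard F₁ F₂  ∎
      where
      open ≤-Reasoning
      P₁ P₂ O₁ O₂ : ℕ
      P₁ = count (inRect tall inShortestRow) L₁
      P₂ = count (inRect tall inShortestRow) L₂
      O₁ = count (offRect tall inShortestRow) L₁
      O₂ = count (offRect tall inShortestRow) L₂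

  threshold-bound : ∀ α → 2 * α ≡ lineSumError F₁ F₂ →
    ∀ u → u * atLeast rowLength rows u ≤ α + interCard F₁ F₂
  threshold-bound α 2α≡ u with 1 ≤? atLeast rowLength rows u
  ... | no  ¬1≤ rewrite n<1⇒n≡0 (≰⇒> ¬1≤) | *-zeroʳ u = z≤n
  ... | yes 1≤  with count-minimal rowLength rows 1≤
  ...   | k* , _ , tall-k* , shortest = ShortestTallRow.bound u k* (≤ᵇ⇒≤ u _ tall-k*) shortest α 2α≡

theorem7 : (F₁ F₂ : FinSet) →
           UniquelyDetermined F₁ →
           ∣ F₁ ∣ ≡ ∣ F₂ ∣ →
           (α : ℕ) → 2 * α ≡ lineSumError F₁ F₂ →
           ∣ F₁ ∣ ≤ floorSum (α + interCard F₁ F₂)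
theorem7 F₁ F₂ ud _ α 2α≡ = begin
  ∣ F₁ ∣                         ≡⟨ ∣F₁∣≡sum-rowLength ⟩
  sum (map rowLength rows)       ≤⟨ sum-≤-floorSum rowLength rows _ (λ u _ → threshold-bound α 2α≡ u) ⟩
  floorSum (α + interCard F₁ F₂) ∎
  where
  open LineSums F₁ F₂
  open NestedRows F₁ F₂ ud
  open ≤-Reasoning
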